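{- The simple permutations of the class $\operatorname{Av}(1342,1423)$ are precisely the simple permutations of the class $\operatorname{Av}(123)$.
   Context: A permutation $\pi$ contains $\sigma$ if $\pi$ has a subsequence order isomorphic to $\sigma$; otherwise it avoids $\sigma$. $\operatorname{Av}(B)$ is the set of all permutations avoiding every permutation in $B$. An interval of a permutation $\pi$ of length $n$ is a set of contiguous positions whose set of values is also contiguous; intervals of size $0$, $1$ and $n$ are trivial. A permutation of length at least $2$ is simple if it has no nontrivial intervals. -}

module Defs where

open import Data.Nat using (ℕ; _+_; _≤_; _<_)
open import Data.Fin using (Fin; toℕ; zero; suc)
open import Data.Product using (Σ; ∃; _×_; _,_)
open import Data.Sum using (_⊎_)
open import Function.Definitions using (Injective)
open import Relation.Binary.PropositionalEquality using (_≡_; refl)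
open import Relation.Nullary using (¬_)
open import Function.Bundles using (_⇔_)

-- A permutation of length n: an injective (hence bijective) map Fin n → Fin n,
-- position i ↦ value π i (0-indexed one-line notation).
record Perm (n : ℕ) : Set where
  constructor perm
  field
    fun : Fin n → Fin n
    inj : Injective _≡_ _≡_ fun
open Perm public

_<ꟳ_ : ∀ {n} → Fin n → Fin n → Set
i <ꟳ j = toℕ i < toℕ j

Contains : ∀ {n k} → Perm n → Perm k → Set
Contains {n} {k} π σ =
  Σ (Fin k → Fin n) λ e →
    (∀ i j → i <ꟳ j → e i <ꟳ e j) ×
    (∀ i j → (fun σ i <ꟳ fun σ j) ⇔ (fun π (e i) <ꟳ fun π (e j)))

Avoids : ∀ {n k} → Perm n → Perm k → Set
Avoids π σ = ¬ Contains π σ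

-- An interval of π of size m: positions a, a+1, …, a+m-1 (with a+m ≤ n)
-- whose set of values is {c, c+1, …, c+m-1} (with c+m ≤ n).  Since π is
-- injective, the value set equals this range iff every value lies in it.
IsInterval : ∀ {n} → Perm n → (a m : ℕ) → Set
IsInterval {n} π a m =
  (a + m ≤ n) ×
  Σ ℕ λ c → (c + m ≤ n) ×
    (∀ (i : Fin n) → a ≤ toℕ i → toℕ i < a + m →
       c ≤ toℕ (fun π i) × toℕ (fun π i) < c + m)

Simple : ∀ {n} → Perm n → Set
Simple {n} π =
  (2 ≤ n) ×
  (∀ a m → IsInterval π a m → (m ≡ 0) ⊎ (m ≡ 1) ⊎ (m ≡ n))

p123-fun : Fin 3 → Fin 3
p123-fun i = i

p123 : Perm 3
p123 = perm p123-fun (λ eq → eq)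

-- 1342 ↦ 0 2 3 1
p1342-fun : Fin 4 → Fin 4
p1342-fun zero = zero
p1342-fun (suc zero) = suc (suc zero)
p1342-fun (suc (suc zero)) = suc (suc (suc zero))
p1342-fun (suc (suc (suc zero))) = suc zero

-- 1423 ↦ 0 3 1 2
p1423-fun : Fin 4 → Fin 4
p1423-fun zero = zero
p1423-fun (suc zero) = suc (suc (suc zero))
p1423-fun (suc (suc zero)) = suc zero
p1423-fun (suc (suc (suc zero))) = suc (suc zero)

p1342-inj : Injective _≡_ _≡_ p1342-fun
p1342-inj {zero} {zero} _ = refl
p1342-inj {suc zero} {suc zero} _ = refl
p1342-inj {suc (suc zero)} {suc (suc zero)} _ = refl
p1342-inj {suc (suc (suc zero))} {suc (suc (suc zero))} _ = refl
p1342-inj {zero} {suc zero} ()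
p1342-inj {zero} {suc (suc zero)} ()
p1342-inj {zero} {suc (suc (suc zero))} ()
p1342-inj {suc zero} {zero} ()
p1342-inj {suc zero} {suc (suc zero)} ()
p1342-inj {suc zero} {suc (suc (suc zero))} ()
p1342-inj {suc (suc zero)} {zero} ()
p1342-inj {suc (suc zero)} {suc zero} ()
p1342-inj {suc (suc zero)} {suc (suc (suc zero))} ()
p1342-inj {suc (suc (suc zero))} {zero} ()
p1342-inj {suc (suc (suc zero))} {suc zero} ()
p1342-inj {suc (suc (suc zero))} {suc (suc zero)} ()

p1423-inj : Injective _≡_ _≡_ p1423-fun
p1423-inj {zero} {zero} _ = refl
p1423-inj {suc zero} {suc zero} _ = refl
p1423-inj {suc (suc zero)} {suc (suc zero)} _ = refl
p1423-inj {suc (suc (suc zero))} {suc (suc (suc zero))} _ = refl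
p1423-inj {zero} {suc zero} ()
p1423-inj {zero} {suc (suc zero)} ()
p1423-inj {zero} {suc (suc (suc zero))} ()
p1423-inj {suc zero} {zero} ()
p1423-inj {suc zero} {suc (suc zero)} ()
p1423-inj {suc zero} {suc (suc (suc zero))} ()
p1423-inj {suc (suc zero)} {zero} ()
p1423-inj {suc (suc zero)} {suc zero} ()
p1423-inj {suc (suc zero)} {suc (suc (suc zero))} ()
p1423-inj {suc (suc (suc zero))} {zero} ()
p1423-inj {suc (suc (suc zero))} {suc zero} ()
p1423-inj {suc (suc (suc zero))} {suc (suc zero)} ()

p1342 : Perm 4
p1342 = perm p1342-fun p1342-inj

p1423 : Perm 4
p1423 = perm p1423-fun p1423-inj

-- 123 occurs in both 1342 and 1423, so one direction is immediate.  Conversely, let π avoid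
-- 1342 and 1423 and contain 123.  Take x the highest bottom of a 123, c the leftmost top of a 123
-- over x, and b the highest point strictly between x and c above x; let h be its value.  Let s
-- be the position just after the last point left of x with value above h, and p the leftmost
-- position that is c or, from s on, lies below a point right of c with value at most h.
-- Avoiding 1342 and 1423 makes the values on [s, p) bounded by h and closed upwards up to h, so
-- [s, p) is an interval; it contains x and b and misses p, hence π is not simple.

module Submission where

open import Defs
open import Data.Nat using (ℕ; zero; suc; _+_; _∸_; _≤_; _<_; z≤n; s≤s; s≤s⁻¹; z<s; s<s)
open import Data.Nat.Properties
open import Data.Fin using (Fin; zero; suc; toℕ; inject₁; fromℕ<; punchOut)
open import Data.Fin.Patterns using (0F; 1F; 2F; 3F)
open import Data.Fin.Properties using (toℕ-injective; toℕ<n; toℕ-fromℕ<; any?; punchOut-injective; injective⇒≤)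
  renaming (_≟_ to _≟ᶠ_)
open import Data.Vec using (_∷_; []; lookup)
open import Data.Product using (∃; ∃₂; _×_; _,_; proj₁; proj₂)
open import Data.Sum using (_⊎_; inj₁; inj₂; [_,_])
open import Data.Empty using (⊥-elim)
open import Function using (_∘_; id; flip)
open import Function.Bundles using (_⇔_; mk⇔; Equivalence)
open import Function.Definitions using (Injective)
import Function.Properties.Equivalence as ⇔
open import Relation.Nullary using (¬_; Dec; yes; no; contradiction)
open import Relation.Nullary.Decidable using (_×-dec_; _⊎-dec_)
open import Level using (0ℓ)
open import Relation.Unary using (Pred; Decidable)
open import Relation.Binary using (Total; Transitive; tri<; tri≈; tri>)
open import Relation.Binary.PropositionalEquality using (_≡_; _≢_; refl; sym; trans; cong; subst; subst₂)

module _ {A : Set} {_≼_ : A → A → Set} (≼-total : Total _≼_) (≼-trans : Transitive _≼_) where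

  private
    ≼-refl : ∀ {a} → a ≼ a
    ≼-refl {a} = [ id , id ] (≼-total a a)

  greatest : ∀ {n} (P : Pred (Fin n) 0ℓ) → Decidable P → (f : Fin n → A) → ∃ P →
    ∃ λ i → P i × (∀ j → P j → f j ≼ f i)
  greatest {zero} _ _ _ (() , _)
  greatest {suc n} P P? f w with any? (P? ∘ suc)
  ... | no ¬tail = zero , P0 w , λ { zero _ → ≼-refl ; (suc j) Pj → ⊥-elim (¬tail (j , Pj)) }
    where
    P0 : ∃ P → P zero
    P0 (zero , P0) = P0
    P0 (suc j , Pj) = ⊥-elim (¬tail (j , Pj))
  ... | yes tail with greatest (P ∘ suc) (P? ∘ suc) (f ∘ suc) tail
  ...   | i , Pi , i-max with P? zero | ≼-total (f zero) (f (suc i))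
  ...     | yes P0 | inj₂ i≼0 = zero , P0 , λ { zero _ → ≼-refl ; (suc j) Pj → ≼-trans (i-max j Pj) i≼0 }
  ...     | yes _  | inj₁ 0≼i = suc i , Pi , λ { zero _ → 0≼i ; (suc j) Pj → i-max j Pj }
  ...     | no ¬P0 | _ = suc i , Pi , λ { zero P0 → ⊥-elim (¬P0 P0) ; (suc j) Pj → i-max j Pj }

max-by : ∀ {n} (P : Pred (Fin n) 0ℓ) → Decidable P → (f : Fin n → ℕ) → ∃ P →
  ∃ λ i → P i × (∀ j → P j → f j ≤ f i)
max-by = greatest ≤-total ≤-trans

min-by : ∀ {n} (P : Pred (Fin n) 0ℓ) → Decidable P → (f : Fin n → ℕ) → ∃ P →
  ∃ λ i → P i × (∀ j → P j → f i ≤ f j)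
min-by = greatest (flip ≤-total) (flip ≤-trans)

value : ∀ {n} → Perm n → Fin n → ℕ
value π i = toℕ (fun π i)

value-injective : ∀ {n} (π : Perm n) {i j} → value π i ≡ value π j → i ≡ j
value-injective π = inj π ∘ toℕ-injective

value-<-or-> : ∀ {n} (π : Perm n) {i j} → i ≢ j → value π i < value π j ⊎ value π j < value π i
value-<-or-> π {i} {j} i≢j with <-cmp (value π i) (value π j)
... | tri< lt _ _ = inj₁ lt
... | tri≈ _ eq _ = ⊥-elim (i≢j (value-injective π eq))
... | tri> _ _ gt = inj₂ gt

fun-surjective : ∀ {n} (π : Perm n) v → ∃ λ i → fun π i ≡ v
fun-surjective {zero} π ()
fun-surjective {suc n} π v with any? (λ i → fun π i ≟ᶠ v)
... | yes hit = hit
... | no miss = ⊥-elim (1+n≰n (injective⇒≤ squeezed-injective))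
  where
  squeezed : Fin (suc n) → Fin n
  squeezed i = punchOut (λ eq → miss (i , sym eq))
  squeezed-injective : Injective _≡_ _≡_ squeezed
  squeezed-injective = inj π ∘ punchOut-injective {i = v} _ _

inverse : ∀ {n} → Perm n → Fin n → Fin n
inverse π v = proj₁ (fun-surjective π v)

inverse-fun : ∀ {n} (π : Perm n) i → inverse π (fun π i) ≡ i
inverse-fun π i = inj π (proj₂ (fun-surjective π (fun π i)))

value-surjective : ∀ {n} (π : Perm n) v → v < n → ∃ λ i → value π i ≡ v
value-surjective π v v<n with fun-surjective π (fromℕ< v<n)
... | i , eq = i , trans (cong toℕ eq) (toℕ-fromℕ< v<n)

contains-of-forward : ∀ {n k} (π : Perm n) (σ : Perm k) (e : Fin k → Fin n) →
  (∀ i j → i <ꟳ j → e i <ꟳ e j) →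
  (∀ i j → fun σ i <ꟳ fun σ j → fun π (e i) <ꟳ fun π (e j)) → Contains π σ
contains-of-forward π σ e e-mono forward = e , e-mono , λ i j → mk⇔ (forward i j) (backward i j)
  where
  backward : ∀ i j → fun π (e i) <ꟳ fun π (e j) → fun σ i <ꟳ fun σ j
  backward i j lt with <-cmp (value σ i) (value σ j)
  ... | tri< σi<σj _ _ = σi<σj
  ... | tri≈ _ σi≡σj _ rewrite value-injective σ σi≡σj = ⊥-elim (<-irrefl refl lt)
  ... | tri> _ _ σj<σi = ⊥-elim (<-asym lt (forward j i σj<σi))

contains-trans : ∀ {n k l} {π : Perm n} {σ : Perm k} {τ : Perm l} →
  Contains π σ → Contains σ τ → Contains π τ
contains-trans (e , e-mono , e-iso) (d , d-mono , d-iso) =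
  e ∘ d , (λ i j → e-mono (d i) (d j) ∘ d-mono i j) , λ i j → ⇔.trans (d-iso i j) (e-iso (d i) (d j))

avoids-of-contained : ∀ {n k l} (π : Perm n) (σ : Perm k) (τ : Perm l) →
  Contains σ τ → Avoids π τ → Avoids π σ
avoids-of-contained π σ τ σ⊇τ π⊉τ π⊇σ = π⊉τ (contains-trans {π = π} {σ} {τ} π⊇σ σ⊇τ)

Increasing : ∀ {k} → (Fin (suc k) → ℕ) → Set
Increasing f = ∀ i → f (inject₁ i) < f (suc i)

increasing⇒monotone : ∀ {k} (f : Fin (suc k) → ℕ) → Increasing f → ∀ i j → i <ꟳ j → f i < f j
increasing⇒monotone {suc k} f f↑ zero (suc zero) _ = f↑ zero
increasing⇒monotone {suc k} f f↑ zero (suc (suc j)) _ =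
  <-trans (f↑ zero) (increasing⇒monotone (f ∘ suc) (f↑ ∘ suc) zero (suc j) z<s)
increasing⇒monotone {suc k} f f↑ (suc i) (suc j) (s<s i<j) = increasing⇒monotone (f ∘ suc) (f↑ ∘ suc) i j i<j

-- An occurrence is recognised by reading positions left to right and values bottom to top.
contains-of-increasing : ∀ {n k} (π : Perm n) (σ : Perm (suc k)) (e : Fin (suc k) → Fin n) →
  Increasing (toℕ ∘ e) → Increasing (value π ∘ e ∘ inverse σ) → Contains π σ
contains-of-increasing π σ e e↑ v↑ = contains-of-forward π σ e (increasing⇒monotone (toℕ ∘ e) e↑) forward
  where
  forward : ∀ i j → fun σ i <ꟳ fun σ j → fun π (e i) <ꟳ fun π (e j)
  forward i j lt = subst₂ (λ a b → value π (e a) < value π (e b)) (inverse-fun σ i) (inverse-fun σ j)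
    (increasing⇒monotone (value π ∘ e ∘ inverse σ) v↑ (fun σ i) (fun σ j) lt)

Ascent : ∀ {n} → Perm n → Fin n → Fin n → Set
Ascent π i j = toℕ i < toℕ j × value π i < value π j

123-at : ∀ {n} (π : Perm n) {a b c} → Ascent π a b → Ascent π b c → Contains π p123
123-at π {a} {b} {c} (a<b , va<vb) (b<c , vb<vc) =
  contains-of-increasing π p123 (lookup (a ∷ b ∷ c ∷ []))
    (λ { 0F → a<b ; 1F → b<c })
    (λ { 0F → va<vb ; 1F → vb<vc })

ascents-of-123 : ∀ {n} (π : Perm n) → Contains π p123 → ∃₂ λ a b → ∃ λ c → Ascent π a b × Ascent π b c
ascents-of-123 π (e , e-mono , e-iso) = e 0F , e 1F , e 2F , ascent 0F 1F z<s , ascent 1F 2F (s<s z<s)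
  where
  ascent : ∀ i j → i <ꟳ j → Ascent π (e i) (e j)
  ascent i j i<j = e-mono i j i<j , Equivalence.to (e-iso i j) i<j

1342-at : ∀ {n} (π : Perm n) {a b c d} → toℕ a < toℕ b → toℕ b < toℕ c → toℕ c < toℕ d →
  value π a < value π d → value π d < value π b → value π b < value π c → Contains π p1342
1342-at π {a} {b} {c} {d} a<b b<c c<d va<vd vd<vb vb<vc =
  contains-of-increasing π p1342 (lookup (a ∷ b ∷ c ∷ d ∷ []))
    (λ { 0F → a<b ; 1F → b<c ; 2F → c<d })
    (λ { 0F → va<vd ; 1F → vd<vb ; 2F → vb<vc })

1423-at : ∀ {n} (π : Perm n) {a b c d} → toℕ a < toℕ b → toℕ b < toℕ c → toℕ c < toℕ d →
  value π a < value π c → value π c < value π d → value π d < value π b → Contains π p1423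
1423-at π {a} {b} {c} {d} a<b b<c c<d va<vc vc<vd vd<vb =
  contains-of-increasing π p1423 (lookup (a ∷ b ∷ c ∷ d ∷ []))
    (λ { 0F → a<b ; 1F → b<c ; 2F → c<d })
    (λ { 0F → va<vc ; 1F → vc<vd ; 2F → vd<vb })

1342-contains-123 : Contains p1342 p123
1342-contains-123 = 123-at p1342 {0F} {1F} {2F} (z<s , z<s) (s<s z<s , s<s (s<s z<s))

1423-contains-123 : Contains p1423 p123
1423-contains-123 = 123-at p1423 {0F} {2F} {3F} (z<s , z<s) (s<s (s<s z<s) , s<s z<s)

ProperInterval : ∀ {n} → Perm n → Set
ProperInterval {n} π = ∃₂ λ a m → IsInterval π a m × 2 ≤ m × m < n

simple⇒¬properInterval : ∀ {n} (π : Perm n) → Simple π → ¬ ProperInterval π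
simple⇒¬properInterval π (_ , trivial) (a , m , m-interval , 2≤m , m<n) with trivial a m m-interval
... | inj₁ refl = contradiction 2≤m λ ()
... | inj₂ (inj₁ refl) = contradiction 2≤m λ { (s≤s ()) }
... | inj₂ (inj₂ refl) = <-irrefl refl m<n

-- Each value v of such a block brings the h + 1 - v values v, …, h into it; counting them shows
-- that its values are exactly h + 1 - (b - a), …, h.
module UpperBlock {n} (π : Perm n) {a b h : ℕ} (a≤b : a ≤ b) (b≤n : b ≤ n) (h<n : h < n)
  (below : ∀ i → a ≤ toℕ i → toℕ i < b → value π i ≤ h)
  (closed : ∀ i j → a ≤ toℕ i → toℕ i < b → value π i ≤ value π j → value π j ≤ h →
              a ≤ toℕ j × toℕ j < b) where

  values-up-to-h : ∀ i → a ≤ toℕ i → toℕ i < b → suc h ∸ value π i ≤ b ∸ a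
  values-up-to-h i a≤i i<b = injective⇒≤ {f = offset} offset-injective
    where
    vi≤1+h : value π i ≤ suc h
    vi≤1+h = m≤n⇒m≤1+n (below i a≤i i<b)

    shifted<1+h : ∀ (t : Fin (suc h ∸ value π i)) → toℕ t + value π i < suc h
    shifted<1+h t = m≤o∸n⇒m+n≤o (suc (toℕ t)) vi≤1+h (toℕ<n t)

    owner : Fin (suc h ∸ value π i) → Fin n
    owner t = proj₁ (value-surjective π (toℕ t + value π i) (≤-trans (shifted<1+h t) h<n))

    owner-value : ∀ t → value π (owner t) ≡ toℕ t + value π i
    owner-value t = proj₂ (value-surjective π (toℕ t + value π i) (≤-trans (shifted<1+h t) h<n))

    owner-in-block : ∀ t → a ≤ toℕ (owner t) × toℕ (owner t) < b
    owner-in-block t = closed i (owner t) a≤i i<b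
      (subst (value π i ≤_) (sym (owner-value t)) (m≤n+m (value π i) (toℕ t)))
      (subst (_≤ h) (sym (owner-value t)) (s≤s⁻¹ (shifted<1+h t)))

    offset : Fin (suc h ∸ value π i) → Fin (b ∸ a)
    offset t = fromℕ< (∸-monoˡ-< (proj₂ (owner-in-block t)) (proj₁ (owner-in-block t)))

    offset-injective : Injective _≡_ _≡_ offset
    offset-injective {t} {t′} eq = toℕ-injective (+-cancelʳ-≡ (value π i) (toℕ t) (toℕ t′)
      (trans (sym (owner-value t)) (trans (cong (value π) same-owner) (owner-value t′))))
      where
      same-owner : owner t ≡ owner t′
      same-owner = toℕ-injective (∸-cancelʳ-≡ (proj₁ (owner-in-block t)) (proj₁ (owner-in-block t′))
        (trans (sym (toℕ-fromℕ< _)) (trans (cong toℕ eq) (toℕ-fromℕ< _))))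

  is-interval : IsInterval π a (b ∸ a)
  is-interval = subst (_≤ n) (sym a+m≡b) b≤n , suc h ∸ (b ∸ a) , bottom+m≤n , bounds
    where
    a+m≡b : a + (b ∸ a) ≡ b
    a+m≡b = m+[n∸m]≡n a≤b

    bottom+m≤n : suc h ∸ (b ∸ a) + (b ∸ a) ≤ n
    bottom+m≤n with ≤-total (b ∸ a) (suc h)
    ... | inj₁ m≤1+h = subst (_≤ n) (sym (m∸n+n≡m m≤1+h)) h<n
    ... | inj₂ 1+h≤m rewrite m≤n⇒m∸n≡0 1+h≤m = ≤-trans (m∸n≤m b a) b≤n

    bounds : ∀ i → a ≤ toℕ i → toℕ i < a + (b ∸ a) →
      suc h ∸ (b ∸ a) ≤ value π i × value π i < suc h ∸ (b ∸ a) + (b ∸ a)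
    bounds i a≤i i<a+m = m≤n+o⇒m∸n≤o (suc h) (b ∸ a) 1+h≤m+vi , vi<bottom+m
      where
      i<b : toℕ i < b
      i<b = subst (toℕ i <_) a+m≡b i<a+m

      1+h≤m+vi : suc h ≤ b ∸ a + value π i
      1+h≤m+vi = subst (_≤ b ∸ a + value π i) (m∸n+n≡m (m≤n⇒m≤1+n (below i a≤i i<b)))
        (+-monoˡ-≤ (value π i) (values-up-to-h i a≤i i<b))

      vi<bottom+m : value π i < suc h ∸ (b ∸ a) + (b ∸ a)
      vi<bottom+m = ≤-trans (s≤s (below i a≤i i<b))
        (subst (suc h ≤_) (+-comm (b ∸ a) _) (m≤n+m∸n (suc h) (b ∸ a)))

module Avoiding {n} (π : Perm n) (no1342 : Avoids π p1342) (no1423 : Avoids π p1423) where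

  private
    pos : Fin n → ℕ
    pos = toℕ

    val : Fin n → ℕ
    val = value π

    _↗_ : Fin n → Fin n → Set
    _↗_ = Ascent π

    ascent? : ∀ i j → Dec (i ↗ j)
    ascent? i j = (pos i <? pos j) ×-dec (val i <? val j)

    apart : ∀ {i j} → pos i < pos j → i ≢ j
    apart i<j refl = <-irrefl refl i<j

  Bottom123 : Fin n → Set
  Bottom123 a = ∃₂ λ b c → a ↗ b × b ↗ c

  Top123Over : Fin n → Fin n → Set
  Top123Over a c = ∃ λ b → a ↗ b × b ↗ c

  bottom123? : ∀ a → Dec (Bottom123 a)
  bottom123? a = any? λ b → any? λ c → ascent? a b ×-dec ascent? b c

  top123Over? : ∀ a c → Dec (Top123Over a c)
  top123Over? a c = any? λ b → ascent? a b ×-dec ascent? b c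

  record Anchor : Set where
    field
      x b c : Fin n
      x↗b : x ↗ b
      b↗c : b ↗ c
      x-max : ∀ y → Bottom123 y → val y ≤ val x
      b-max : ∀ r → x ↗ r → pos r < pos c → val r ≤ val b

  middle-below-top : ∀ {x b₀ b c} → x ↗ b₀ → b₀ ↗ c → (∀ c′ → Top123Over x c′ → pos c ≤ pos c′) →
    x ↗ b → pos b < pos c → val b < val c
  middle-below-top {x} {b₀} {b} {c} x↗b₀ b₀↗c c-min x↗b b<c with value-<-or-> π (apart b<c)
  ... | inj₁ vb<vc = vb<vc
  ... | inj₂ vc<vb with <-cmp (pos b) (pos b₀)
  ...   | tri< b<b₀ _ _ = ⊥-elim (no1423 (1423-at π (proj₁ x↗b) b<b₀ (proj₁ b₀↗c)
                                                  (proj₂ x↗b₀) (proj₂ b₀↗c) vc<vb))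
  ...   | tri≈ _ b≡b₀ _ rewrite toℕ-injective b≡b₀ = ⊥-elim (<-asym vc<vb (proj₂ b₀↗c))
  ...   | tri> _ _ b₀<b = ⊥-elim (<⇒≱ b<c (c-min b (b₀ , x↗b₀ , b₀<b , <-trans (proj₂ b₀↗c) vc<vb)))

  anchor-of-123 : Contains π p123 → Anchor
  anchor-of-123 occ
    with max-by Bottom123 bottom123? val (ascents-of-123 π occ)
  ... | x , (b₁ , c₁ , x↗b₁ , b₁↗c₁) , x-max
    with min-by (Top123Over x) (top123Over? x) pos (c₁ , b₁ , x↗b₁ , b₁↗c₁)
  ... | c , (b₀ , x↗b₀ , b₀↗c) , c-min
    with max-by (λ r → x ↗ r × pos r < pos c) (λ r → ascent? x r ×-dec (pos r <? pos c)) val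
                (b₀ , x↗b₀ , proj₁ b₀↗c)
  ... | b , (x↗b , b<c) , b-max = record
    { x = x ; b = b ; c = c ; x↗b = x↗b
    ; b↗c = b<c , middle-below-top x↗b₀ b₀↗c c-min x↗b b<c
    ; x-max = x-max
    ; b-max = λ r x↗r r<c → b-max r (x↗r , r<c) }

  module WithAnchor (A : Anchor) where
    open Anchor A

    h : ℕ
    h = val b

    x<b : pos x < pos b
    x<b = proj₁ x↗b

    b<c : pos b < pos c
    b<c = proj₁ b↗c

    vx<h : val x < h
    vx<h = proj₂ x↗b

    h<vc : h < val c
    h<vc = proj₂ b↗c

    below-h : ∀ {y} → y ≢ b → val y ≤ h → val y < h
    below-h y≢b vy≤h = ≤∧≢⇒< vy≤h (y≢b ∘ value-injective π)

    left-low⇒below-x : ∀ y → pos y < pos x → val y ≤ h → val y < val x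
    left-low⇒below-x y y<x vy≤h with value-<-or-> π (apart y<x)
    ... | inj₁ vy<vx = vy<vx
    ... | inj₂ vx<vy = ⊥-elim (<⇒≱ vx<vy (x-max y (b , c , y↗b , b↗c)))
      where
      y↗b : y ↗ b
      y↗b = <-trans y<x x<b , below-h (apart (<-trans y<x x<b)) vy≤h

    right-low⇒below-x : ∀ e → pos c < pos e → val e ≤ h → val e < val x
    right-low⇒below-x e c<e ve≤h with value-<-or-> π (apart (<-trans (<-trans x<b b<c) c<e))
    ... | inj₂ ve<vx = ve<vx
    ... | inj₁ vx<ve = ⊥-elim (no1342 (1342-at π x<b b<c c<e vx<ve
                                         (below-h (apart (<-trans b<c c<e) ∘ sym) ve≤h) h<vc))

    record BlockStart (s : ℕ) : Set where
      field
        s≤x : s ≤ pos x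
        high-before : ∀ y → pos y < s → h < val y
        low-from : ∀ y → s ≤ pos y → pos y < pos x → val y ≤ h

    block-start : ∃ BlockStart
    block-start with any? (λ w → (pos w <? pos x) ×-dec (h <? val w))
    ... | no none = 0 , record
      { s≤x = z≤n
      ; high-before = λ _ ()
      ; low-from = λ y _ y<x → ≮⇒≥ (λ h<vy → none (y , y<x , h<vy)) }
    ... | yes some with max-by (λ w → pos w < pos x × h < val w)
                               (λ w → (pos w <? pos x) ×-dec (h <? val w)) pos some
    ... | w , (w<x , h<vw) , w-max = suc (pos w) , record
      { s≤x = w<x
      ; high-before = high-before
      ; low-from = λ y w<y y<x → ≮⇒≥ (λ h<vy → <⇒≱ w<y (w-max y (y<x , h<vy))) }
      where
      high-before : ∀ y → pos y < suc (pos w) → h < val y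
      high-before y y≤w with h <? val y
      ... | yes h<vy = h<vy
      ... | no h≮vy with m≤n⇒m<n∨m≡n (s≤s⁻¹ y≤w)
      ...   | inj₂ y≡w rewrite toℕ-injective y≡w = ⊥-elim (h≮vy h<vw)
      ...   | inj₁ y<w = ⊥-elim (no1423 (1423-at π y<w w<x x<b
                            (left-low⇒below-x y (<-trans y<w w<x) (≮⇒≥ h≮vy)) vx<h h<vw))

    module WithStart {s} (S : BlockStart s) where
      open BlockStart S

      low-before-c : ∀ y → s ≤ pos y → pos y < pos c → val y ≤ h
      low-before-c y s≤y y<c with <-cmp (pos y) (pos x)
      ... | tri< y<x _ _ = low-from y s≤y y<x
      ... | tri≈ _ y≡x _ rewrite toℕ-injective y≡x = <⇒≤ vx<h
      ... | tri> _ _ x<y with value-<-or-> π (apart x<y)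
      ...   | inj₁ vx<vy = b-max y (x<y , vx<vy) y<c
      ...   | inj₂ vy<vx = <⇒≤ (<-trans vy<vx vx<h)

      Late : Fin n → Set
      Late e = pos c < pos e × val e ≤ h

      late-not-above : ∀ q e → s ≤ pos q → pos q ≤ pos b → Late e → ¬ (val q < val e)
      late-not-above q e s≤q q≤b (c<e , ve≤h) vq<ve
        with right-low⇒below-x e c<e ve≤h | <-cmp (pos q) (pos x)
      ... | ve<vx | tri< q<x _ _ = no1342 (1342-at π q<x x<b (<-trans b<c c<e) vq<ve ve<vx vx<h)
      ... | ve<vx | tri≈ _ q≡x _ rewrite toℕ-injective q≡x = <-asym vq<ve ve<vx
      ... | ve<vx | tri> _ _ x<q with value-<-or-> π (apart x<q)
      ...   | inj₁ vx<vq = <-asym vq<ve (<-trans ve<vx vx<vq)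
      ...   | inj₂ vq<vx = no1342 (1342-at π q<b b<c c<e vq<ve (<-trans ve<vx vx<h) h<vc)
        where
        q<b : pos q < pos b
        q<b = ≤∧≢⇒< q≤b (λ q≡b → <-irrefl (cong val (toℕ-injective q≡b)) (<-trans vq<vx vx<h))

      -- A block containing a blocking position would, being closed upwards up to h, also contain
      -- a late position, which lies beyond c.
      Blocking : Fin n → Set
      Blocking p = p ≡ c ⊎ (s ≤ pos p × ∃ λ e → Late e × val p < val e)

      blocking? : ∀ p → Dec (Blocking p)
      blocking? p = (p ≟ᶠ c) ⊎-dec ((s ≤? pos p) ×-dec
                      any? (λ e → ((pos c <? pos e) ×-dec (val e ≤? h)) ×-dec (val p <? val e)))

      module WithEnd (p : Fin n) (p-blocking : Blocking p) (p-min : ∀ q → Blocking q → pos p ≤ pos q) where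

        p≤c : pos p ≤ pos c
        p≤c = p-min c (inj₁ refl)

        b<p : pos b < pos p
        b<p with pos b <? pos p
        ... | yes b<p = b<p
        ... | no b≮p = ⊥-elim (not-blocking p-blocking)
          where
          not-blocking : ¬ Blocking p
          not-blocking (inj₁ p≡c) = b≮p (subst (λ t → pos b < pos t) (sym p≡c) b<c)
          not-blocking (inj₂ (s≤p , e , e-late , vp<ve)) = late-not-above p e s≤p (≮⇒≥ b≮p) e-late vp<ve

        s≤p : s ≤ pos p
        s≤p = ≤-trans s≤x (<⇒≤ (<-trans x<b b<p))

        late-witness : pos p < pos c → ∃ λ e → Late e × val p < val e
        late-witness p<c = witness p-blocking
          where
          witness : Blocking p → ∃ λ e → Late e × val p < val e
          witness (inj₁ p≡c) = ⊥-elim (<-irrefl (cong pos p≡c) p<c)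
          witness (inj₂ (_ , e-late)) = e-late

        late-below-block : ∀ q e → s ≤ pos q → pos q < pos p → Late e → val e ≤ val q
        late-below-block q e s≤q q<p e-late =
          ≮⇒≥ (λ vq<ve → <⇒≱ q<p (p-min q (inj₂ (s≤q , e , e-late , vq<ve))))

        block-below : ∀ q → s ≤ pos q → pos q < pos p → val q ≤ h
        block-below q s≤q q<p = low-before-c q s≤q (<-≤-trans q<p p≤c)

        block-closed : ∀ q r → s ≤ pos q → pos q < pos p → val q ≤ val r → val r ≤ h →
          s ≤ pos r × pos r < pos p
        block-closed q r s≤q q<p vq≤vr vr≤h = s≤r , r<p
          where
          s≤r : s ≤ pos r
          s≤r = ≮⇒≥ (λ r<s → <⇒≱ (high-before r r<s) vr≤h)

          r<p : pos r < pos p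
          r<p with pos r <? pos p
          ... | yes r<p = r<p
          ... | no r≮p with <-cmp (pos r) (pos c)
          ...   | tri> _ _ c<r = ⊥-elim (<⇒≱ vq<vr (late-below-block q r s≤q q<p (c<r , vr≤h)))
            where
            vq<vr : val q < val r
            vq<vr = ≤∧≢⇒< vq≤vr (apart (<-≤-trans q<p (≮⇒≥ r≮p)) ∘ value-injective π)
          ...   | tri≈ _ r≡c _ rewrite toℕ-injective r≡c = ⊥-elim (<⇒≱ h<vc vr≤h)
          ...   | tri< r<c _ _ with late-witness (≤-<-trans (≮⇒≥ r≮p) r<c)
          ...     | e , (c<e , ve≤h) , vp<ve =
                      ⊥-elim (no1342 (1342-at π p<r r<c c<e vp<ve ve<vr (≤-<-trans vr≤h h<vc)))
            where
            ve<vr : val e < val r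
            ve<vr = ≤∧≢⇒< (≤-trans (late-below-block q e s≤q q<p (c<e , ve≤h)) vq≤vr)
                          (apart (<-trans r<c c<e) ∘ sym ∘ value-injective π)
            p<r : pos p < pos r
            p<r = ≤∧≢⇒< (≮⇒≥ r≮p) (λ p≡r → <-irrefl (cong val (toℕ-injective p≡r)) (<-trans vp<ve ve<vr))

        proper-interval : ProperInterval π
        proper-interval = s , pos p ∸ s ,
          UpperBlock.is-interval π s≤p (<⇒≤ (toℕ<n p)) (toℕ<n (fun π b)) block-below block-closed ,
          m+n≤o⇒m≤o∸n 2 (≤-trans (s≤s (≤-trans (s≤s s≤x) x<b)) b<p) ,
          ≤-<-trans (m∸n≤m (pos p) s) (toℕ<n p)

      proper-interval : ProperInterval π
      proper-interval with min-by Blocking blocking? pos (c , inj₁ refl)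
      ... | p , p-blocking , p-min = WithEnd.proper-interval p p-blocking p-min

    proper-interval : ProperInterval π
    proper-interval = WithStart.proper-interval (proj₂ block-start)

  simple⇒avoids-123 : Simple π → Avoids π p123
  simple⇒avoids-123 simple = simple⇒¬properInterval π simple ∘ WithAnchor.proper-interval ∘ anchor-of-123

proposition5p1 : ∀ (n : ℕ) (π : Perm n) →
    (Simple π × Avoids π p1342 × Avoids π p1423) ⇔ (Simple π × Avoids π p123)
proposition5p1 n π = mk⇔
  (λ { (simple , no1342 , no1423) → simple , Avoiding.simple⇒avoids-123 π no1342 no1423 simple })
  (λ { (simple , no123) → simple , avoids-of-contained π p1342 p123 1342-contains-123 no123
                                 , avoids-of-contained π p1423 p123 1423-contains-123 no123 })
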